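{- Let $n\ge 1$ and let $\lambda\sim\mu$ be an edge of the partition graph $G_n$. Then $|\sigma(\mu)-\sigma(\lambda)|\le 2$. Equivalently, for every oriented edge $e=(\lambda,\mu)$ of $G_n$, $\Delta_e\sigma=\sigma(\mu)-\sigma(\lambda)\in\{ -2,-1,0,1,2\}$.
   Context: For $n\ge1$, $\mathrm{Par}(n)$ is the set of integer partitions of $n$. The partition graph $G_n$ has vertex set $\mathrm{Par}(n)$; $\lambda\sim\mu$ iff $\mu\neq\lambda$ and $\mu$ is obtained from $\lambda$ by an elementary transfer: choose a donor part of size $p\ge1$ and a recipient of size $q\ge0$ (where $q>0$ means an existing part of size $q$, distinct from the donor part, and $q=0$ means creating a new part), replace $p\mapsto p-1$ and $q\mapsto q+1$, omit parts of size $0$, and reorder. Writing $\lambda=(1^{m_1}2^{m_2}\cdots)$ in multiplicity notation, $\mathrm{supp}(\lambda)=\{i\ge1: m_i(\lambda)>0\}$ and $\sigma(\lambda)=|\mathrm{supp}(\lambda)|$ is the support size. -}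

module Defs where

open import Data.Nat using (ℕ; zero; suc; _≤_; _≥_; _∸_; _+_; _≟_)
open import Data.List using (List; []; _∷_; length; deduplicate)
open import Data.Nat.ListAction using (sum)
open import Data.List.Relation.Unary.All using (All)
open import Data.List.Relation.Unary.Linked using (Linked)
open import Data.List.Relation.Binary.Permutation.Propositional using (_↭_)
open import Data.Product using (Σ; _×_; ∃)
open import Data.Sum using (_⊎_)
open import Relation.Binary.PropositionalEquality using (_≡_)
open import Relation.Nullary using (¬_)

IsPartition : ℕ → List ℕ → Set
IsPartition n xs = All (λ x → 1 ≤ x) xs × Linked _≥_ xs × sum xs ≡ n

dropZeros : List ℕ → List ℕ
dropZeros [] = []
dropZeros (zero ∷ xs) = dropZeros xs
dropZeros (suc x ∷ xs) = suc x ∷ dropZeros xs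

-- Elementary transfer (as multisets, i.e. up to reordering):
--  * donor part p ≥ 1 and an existing distinct recipient part q:
--      λ ↭ p ∷ q ∷ rest  and  μ ↭ dropZeros ((p ∸ 1) ∷ (q + 1) ∷ rest)
--  * donor part p ≥ 1 and a new part (q = 0):
--      λ ↭ p ∷ rest      and  μ ↭ dropZeros ((p ∸ 1) ∷ 1 ∷ rest)
Transfer : List ℕ → List ℕ → Set
Transfer lam mu =
  (Σ ℕ λ p → Σ ℕ λ q → Σ (List ℕ) λ rest →
     1 ≤ p × lam ↭ (p ∷ q ∷ rest) × mu ↭ dropZeros ((p ∸ 1) ∷ (q + 1) ∷ rest))
  ⊎
  (Σ ℕ λ p → Σ (List ℕ) λ rest →
     1 ≤ p × lam ↭ (p ∷ rest) × mu ↭ dropZeros ((p ∸ 1) ∷ 1 ∷ rest))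

Adjacent : ℕ → List ℕ → List ℕ → Set
Adjacent n lam mu =
  IsPartition n lam × IsPartition n mu × ¬ (mu ≡ lam) × Transfer lam mu

σ : List ℕ → ℕ
σ xs = length (deduplicate _≟_ xs)

{-# OPTIONS --safe #-}
module Submission where

-- An elementary transfer removes at most two parts of λ (donor and recipient) and
-- inserts at most two parts (the decremented donor, dropped if it becomes 0, and the
-- incremented recipient), leaving a common multiset of parts `rest` untouched.
-- Prepending one entry to a list raises its number of distinct entries by 0 or 1,
-- so σ λ and σ μ both lie in [σ rest, σ rest + 2] and differ by at most 2.

open import Defs
open import Data.Nat using (ℕ; _≤_)
open import Data.List using (List)
open import Data.Integer using (+_; _-_; ∣_∣)

open import Data.Nat using (zero; suc; _≟_; _+_; _∸_; z≤n; s≤s)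
open import Data.Nat.Properties
  using (≤-refl; ≤-reflexive; ≤-trans; ≤-total; +-monoˡ-≤; m≤n⇒m≤1+n; ∸-mono; m+n∸n≡m)
open import Data.Integer.Properties using (m-n≡m⊖n; ∣m⊖n∣≡∣n⊖m∣; ∣⊖∣-≤)
open import Data.List using ([]; _∷_; _++_; length; deduplicate)
open import Data.List.Properties using (filter-all)
open import Data.List.Membership.Propositional using (_∈_; _∉_)
open import Data.List.Membership.Propositional.Properties using (deduplicate-∈⇔)
open import Data.List.Membership.Propositional.Properties.WithK using (unique∧set⇒bag)
open import Data.List.Membership.DecPropositional _≟_ using (_∈?_)
open import Data.List.Relation.Unary.All using (All; []; _∷_; tabulate)
open import Data.List.Relation.Unary.All.Properties using (++⁻ʳ)
open import Data.List.Relation.Unary.Any using (here; there)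
open import Data.List.Relation.Unary.Unique.DecPropositional.Properties _≟_ using (deduplicate-!)
open import Data.List.Relation.Binary.BagAndSetEquality
  using (_∼[_]_; set; [_]-Equality; bag-=⇒; ↭⇒∼bag; ∼bag⇒↭)
open import Data.List.Relation.Binary.Permutation.Propositional
  using (_↭_; ↭-reflexive; ↭-trans)
open import Data.List.Relation.Binary.Permutation.Propositional.Properties
  using (↭-length; All-resp-↭)
open import Data.Product using (_×_; _,_)
open import Data.Sum using (inj₁; inj₂)
open import Function using (_∘_; mk⇔; module Equivalence)
open import Relation.Binary.Bundles using (Setoid)
open import Relation.Binary.PropositionalEquality using (_≡_; _≢_; refl; cong)
open import Relation.Nullary using (yes; no; ¬?)

module SetEq = Setoid ([ set ]-Equality ℕ)

deduplicate-∼set : (xs : List ℕ) → xs ∼[ set ] deduplicate _≟_ xs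
deduplicate-∼set xs = deduplicate-∈⇔ _≟_

σ-resp-∼set : {xs ys : List ℕ} → xs ∼[ set ] ys → σ xs ≡ σ ys
σ-resp-∼set {xs} {ys} xs∼ys =
  ↭-length (∼bag⇒↭ (unique∧set⇒bag (deduplicate-! xs) (deduplicate-! ys) dedup-xs∼dedup-ys))
  where
  dedup-xs∼dedup-ys : deduplicate _≟_ xs ∼[ set ] deduplicate _≟_ ys
  dedup-xs∼dedup-ys =
    SetEq.trans (SetEq.sym (deduplicate-∼set xs)) (SetEq.trans xs∼ys (deduplicate-∼set ys))

σ-resp-↭ : {xs ys : List ℕ} → xs ↭ ys → σ xs ≡ σ ys
σ-resp-↭ xs↭ys = σ-resp-∼set (bag-=⇒ (↭⇒∼bag xs↭ys))

σ-∷-∈ : {x : ℕ} {xs : List ℕ} → x ∈ xs → σ (x ∷ xs) ≡ σ xs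
σ-∷-∈ {x} {xs} x∈xs = σ-resp-∼set (mk⇔ absorb there)
  where
  absorb : {z : ℕ} → z ∈ x ∷ xs → z ∈ xs
  absorb (here refl) = x∈xs
  absorb (there z∈xs) = z∈xs

σ-∷-∉ : {x : ℕ} {xs : List ℕ} → x ∉ xs → σ (x ∷ xs) ≡ suc (σ xs)
σ-∷-∉ {x} {xs} x∉xs = cong (suc ∘ length) (filter-all (λ y → ¬? (x ≟ y)) (tabulate x≢))
  where
  x≢ : {y : ℕ} → y ∈ deduplicate _≟_ xs → x ≢ y
  x≢ y∈ refl = x∉xs (Equivalence.from (deduplicate-∼set xs) y∈)

σ-∷-bounds : (x : ℕ) (xs : List ℕ) → σ xs ≤ σ (x ∷ xs) × σ (x ∷ xs) ≤ suc (σ xs)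
σ-∷-bounds x xs with x ∈? xs
... | yes x∈xs rewrite σ-∷-∈ x∈xs = ≤-refl , m≤n⇒m≤1+n ≤-refl
... | no x∉xs rewrite σ-∷-∉ x∉xs = m≤n⇒m≤1+n ≤-refl , ≤-refl

σ-++-bounds : (xs ys : List ℕ) → σ ys ≤ σ (xs ++ ys) × σ (xs ++ ys) ≤ length xs + σ ys
σ-++-bounds [] ys = ≤-refl , ≤-refl
σ-++-bounds (x ∷ xs) ys with σ-++-bounds xs ys | σ-∷-bounds x (xs ++ ys)
... | lower , upper | lower′ , upper′ = ≤-trans lower lower′ , ≤-trans upper′ (s≤s upper)

∣-∣≤-within : {r k m n : ℕ} → r ≤ m × m ≤ k + r → r ≤ n × n ≤ k + r → ∣ + n - + m ∣ ≤ k
∣-∣≤-within {r} {k} {m} {n} (r≤m , m≤k+r) (r≤n , n≤k+r)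
  rewrite m-n≡m⊖n n m with ≤-total m n
... | inj₁ m≤n rewrite ∣m⊖n∣≡∣n⊖m∣ n m | ∣⊖∣-≤ m≤n =
  ≤-trans (∸-mono n≤k+r r≤m) (≤-reflexive (m+n∸n≡m k r))
... | inj₂ n≤m rewrite ∣⊖∣-≤ n≤m =
  ≤-trans (∸-mono m≤k+r r≤n) (≤-reflexive (m+n∸n≡m k r))

record Exchange (k : ℕ) (xs ys : List ℕ) : Set where
  field
    removed added common : List ℕ
    removed≤k : length removed ≤ k
    added≤k : length added ≤ k
    xs↭ : xs ↭ removed ++ common
    ys↭ : ys ↭ added ++ common

σ-exchange : {k : ℕ} {xs ys : List ℕ} → Exchange k xs ys → ∣ + σ ys - + σ xs ∣ ≤ k
σ-exchange {k} e rewrite σ-resp-↭ (Exchange.xs↭ e) | σ-resp-↭ (Exchange.ys↭ e) =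
  ∣-∣≤-within (within removed removed≤k) (within added added≤k)
  where
  open Exchange e
  within : (zs : List ℕ) → length zs ≤ k →
           σ common ≤ σ (zs ++ common) × σ (zs ++ common) ≤ k + σ common
  within zs zs≤k with σ-++-bounds zs common
  ... | lower , upper = lower , ≤-trans upper (+-monoˡ-≤ (σ common) zs≤k)

dropZeros-positive : {xs : List ℕ} → All (1 ≤_) xs → dropZeros xs ≡ xs
dropZeros-positive [] = refl
dropZeros-positive {suc x ∷ xs} (_ ∷ xs⁺) = cong (suc x ∷_) (dropZeros-positive xs⁺)

dropZeros-++-positive : (xs : List ℕ) {ys : List ℕ} → All (1 ≤_) ys →
                        dropZeros (xs ++ ys) ≡ dropZeros xs ++ ys
dropZeros-++-positive [] ys⁺ = dropZeros-positive ys⁺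
dropZeros-++-positive (zero ∷ xs) ys⁺ = dropZeros-++-positive xs ys⁺
dropZeros-++-positive (suc x ∷ xs) ys⁺ = cong (suc x ∷_) (dropZeros-++-positive xs ys⁺)

length-dropZeros : (xs : List ℕ) → length (dropZeros xs) ≤ length xs
length-dropZeros [] = ≤-refl
length-dropZeros (zero ∷ xs) = m≤n⇒m≤1+n (length-dropZeros xs)
length-dropZeros (suc x ∷ xs) = s≤s (length-dropZeros xs)

exchange-dropZeros : {k : ℕ} {xs ys : List ℕ} (removed added common : List ℕ) →
                     All (1 ≤_) xs → length removed ≤ k → length added ≤ k →
                     xs ↭ removed ++ common → ys ↭ dropZeros (added ++ common) →
                     Exchange k xs ys
exchange-dropZeros removed added common xs⁺ removed≤k added≤k xs↭ ys↭ = record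
  { removed = removed
  ; added = dropZeros added
  ; common = common
  ; removed≤k = removed≤k
  ; added≤k = ≤-trans (length-dropZeros added) added≤k
  ; xs↭ = xs↭
  ; ys↭ = ↭-trans ys↭ (↭-reflexive (dropZeros-++-positive added common⁺))
  }
  where
  common⁺ : All (1 ≤_) common
  common⁺ = ++⁻ʳ removed (All-resp-↭ xs↭ xs⁺)

transfer⇒exchange : {lam mu : List ℕ} → All (1 ≤_) lam → Transfer lam mu → Exchange 2 lam mu
transfer⇒exchange lam⁺ (inj₁ (p , q , rest , _ , lam↭ , mu↭)) =
  exchange-dropZeros (p ∷ q ∷ []) (p ∸ 1 ∷ q + 1 ∷ []) rest lam⁺ ≤-refl ≤-refl lam↭ mu↭
transfer⇒exchange lam⁺ (inj₂ (p , rest , _ , lam↭ , mu↭)) =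
  exchange-dropZeros (p ∷ []) (p ∸ 1 ∷ 1 ∷ []) rest lam⁺ (s≤s z≤n) ≤-refl lam↭ mu↭

mainTheorem1 : (n : ℕ) → 1 ≤ n → (lam mu : List ℕ) → Adjacent n lam mu →
    ∣ (+ σ mu) - (+ σ lam) ∣ ≤ 2
mainTheorem1 _ _ _ _ ((lam⁺ , _) , _ , _ , transfer) = σ-exchange (transfer⇒exchange lam⁺ transfer)
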